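{- Let $q\geq 2$ and let $C$ be a completely regular code in $H(3,q)$ with covering radius $1$, eigenvalue $\lambda_2(3,q)$ and parameter $\gamma<q/2$. If there are $(x_1,x_2,u)\in C$ and $v\in\mathcal{A}$ such that $(\chi_C)_{3,u,v}$ is a cross and $(\chi_C)_{3,u,v}(x_1,x_2)=1$, then $(x_1,x_2,u)$ is contained in a maximum clique of $H(3,q)$ all of whose vertices belong to $C$.
   Context: Let $\mathcal{A}$ be a set of size $q$; $H(3,q)$ has vertex set $\mathcal{A}^3$, tuples adjacent iff they differ in exactly one position; $\lambda_2(3,q)=q-3$. A set $C$ of vertices is a completely regular code with covering radius $1$ if $C$ is a nonempty proper subset and there are integers $\beta,\gamma\geq1$ such that every vertex of $C$ has exactly $\beta$ neighbours outside $C$ and every vertex outside $C$ has exactly $\gamma$ neighbours in $C$; it has eigenvalue $\lambda_2(3,q)$ iff $\beta+\gamma=2q$. A maximum clique is a set of $q$ tuples agreeing in all positions except one position $i$ and taking all $q$ symbols in position $i$. $\chi_C$ is the characteristic function of $C$, and for $u,v\in\mathcal{A}$, $(\chi_C)_{3,u,v}:\mathcal{A}^2\to\{ -1,0,1\}$ is defined by $(\chi_C)_{3,u,v}(y_1,y_2)=\chi_C(y_1,y_2,u)-\chi_C(y_1,y_2,v)$. A function $f:\mathcal{A}^2\to\mathbb{Z}$ is a cross if there are nonempty proper subsets $X,Y\subseteq\mathcal{A}$ with $|X|=|Y|$ such that $f(y)=1$ if $y_1\in X$ and $y_2\notin Y$, $f(y)=-1$ if $y_1\notin X$ and $y_2\in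 Y$, and $f(y)=0$ otherwise. -}

module Defs where

open import Data.Nat using (ℕ; zero; suc; _+_; _*_; _<_; _≤_)
open import Data.Fin using (Fin)
open import Data.Fin.Properties using (_≟_)
open import Data.Bool using (Bool; true; false; if_then_else_; _∧_; not)
open import Data.Integer using (ℤ; +_; _-_) renaming (-_ to neg)
open import Data.List using (List; map; concatMap; allFin)
open import Data.Nat.ListAction using (sum)
open import Data.Product using (_×_; _,_; Σ; ∃; ∃-syntax)
open import Relation.Nullary.Decidable using (⌊_⌋)
open import Relation.Binary.PropositionalEquality using (_≡_)

-- Alphabet 𝒜 = Fin q ; vertices of H(3,q) are triples over 𝒜.
Vertex : ℕ → Set
Vertex q = Fin q × Fin q × Fin q

vertices : (q : ℕ) → List (Vertex q)
vertices q = concatMap (λ a → concatMap (λ b → map (λ c → (a , b , c)) (allFin q)) (allFin q)) (allFin q)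

card : {q : ℕ} → (Fin q → Bool) → ℕ
card {q} X = sum (map (λ a → if X a then 1 else 0) (allFin q))

differ : {q : ℕ} → Fin q → Fin q → ℕ
differ a b = if ⌊ a ≟ b ⌋ then 0 else 1

dist : {q : ℕ} → Vertex q → Vertex q → ℕ
dist (a₁ , a₂ , a₃) (b₁ , b₂ , b₃) = differ a₁ b₁ + differ a₂ b₂ + differ a₃ b₃

adjacent : {q : ℕ} → Vertex q → Vertex q → Bool
adjacent x y = ⌊ Data.Nat._≟_ (dist x y) 1 ⌋

-- a code is given by its characteristic function χ_C : 𝒜³ → {0,1}
Code : ℕ → Set
Code q = Vertex q → Bool

neighboursOutside : {q : ℕ} → Code q → Vertex q → ℕ
neighboursOutside {q} C x = sum (map (λ y → if adjacent x y ∧ not (C y) then 1 else 0) (vertices q))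

neighboursInside : {q : ℕ} → Code q → Vertex q → ℕ
neighboursInside {q} C x = sum (map (λ y → if adjacent x y ∧ C y then 1 else 0) (vertices q))

IsCRC1 : {q : ℕ} → Code q → ℕ → ℕ → Set
IsCRC1 {q} C β γ =
  (∃[ x ] C x ≡ true) × (∃[ x ] C x ≡ false) × 1 ≤ β × 1 ≤ γ ×
  (∀ x → C x ≡ true → neighboursOutside C x ≡ β) ×
  (∀ x → C x ≡ false → neighboursInside C x ≡ γ)

-- eigenvalue λ₂(3,q) = q - 3 condition: β + γ = 2q
HasEigenvalueλ₂ : ℕ → ℕ → ℕ → Set
HasEigenvalueλ₂ q β γ = β + γ ≡ 2 * q

χ : {q : ℕ} → Code q → Vertex q → ℤ
χ C x = if C x then + 1 else + 0

χ₃ : {q : ℕ} → Code q → Fin q → Fin q → Fin q × Fin q → ℤ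
χ₃ C u v (y₁ , y₂) = χ C (y₁ , y₂ , u) - χ C (y₁ , y₂ , v)

NonemptyProper : {q : ℕ} → (Fin q → Bool) → Set
NonemptyProper X = (∃[ a ] X a ≡ true) × (∃[ a ] X a ≡ false)

crossValue : {q : ℕ} → (Fin q → Bool) → (Fin q → Bool) → Fin q × Fin q → ℤ
crossValue X Y (y₁ , y₂) =
  if X y₁ ∧ not (Y y₂) then + 1
  else if not (X y₁) ∧ Y y₂ then neg (+ 1)
  else + 0

IsCross : {q : ℕ} → (Fin q × Fin q → ℤ) → Set
IsCross {q} f = Σ (Fin q → Bool) λ X → Σ (Fin q → Bool) λ Y →
  NonemptyProper X × NonemptyProper Y × card X ≡ card Y ×
  (∀ y → f y ≡ crossValue X Y y)

replace : {q : ℕ} → Fin 3 → Vertex q → Fin q → Vertex q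
replace Fin.zero (x₁ , x₂ , x₃) a = (a , x₂ , x₃)
replace (Fin.suc Fin.zero) (x₁ , x₂ , x₃) a = (x₁ , a , x₃)
replace (Fin.suc (Fin.suc Fin.zero)) (x₁ , x₂ , x₃) a = (x₁ , x₂ , a)

-- the maximum clique through x in direction i: { replace i x a | a ∈ 𝒜 }.
-- Every maximum clique containing x is of this form.
-- x lies in a maximum clique all of whose vertices are in C:
InMaxCliqueInside : {q : ℕ} → Code q → Vertex q → Set
InMaxCliqueInside {q} C x = ∃[ i ] (∀ (a : Fin q) → C (replace i x a) ≡ true)

-- From χ₃(x₁,x₂) = 1 the cross gives x₁ ∈ X and x₂ ∉ Y. If neither the line (x₁,·,u) nor
-- the line (·,x₂,u) lay inside C, pick (x₁,b,u) ∉ C and (a,x₂,u) ∉ C. The cross then forces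
-- b ∈ Y and a ∉ X, so it vanishes at (x₁,b) and (a,x₂), and (x₁,b,v), (a,x₂,v) ∉ C as well.
-- Where the cross is −1 the v-layer lies in C, so (a′,b,v) ∈ C for all a′ ∉ X and
-- (a,b′,v) ∈ C for all b′ ∈ Y: neighbours of the two outside vertices. Hence
-- q = |Y| + |𝒜 ∖ X| ≤ 2γ, contradicting 2γ < q. Only the regularity of the vertices
-- outside C enters.

module Submission where

open import Defs
open import Data.Nat using (ℕ; suc; _+_; _*_; _≤_; _<_; z≤n)
open import Data.Nat.Properties using (≤-refl; ≤-trans; +-mono-≤; m≤m+n; m≤n+m; +-suc; +-identityʳ; <⇒≱; module ≤-Reasoning)
open import Data.Nat.ListAction using (sum)
open import Data.Nat.ListAction.Properties using (sum-++)
open import Data.Fin using (Fin)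
open import Data.Fin.Properties using (all?; ¬∀⟶∃¬) renaming (_≟_ to _≟ᶠ_)
open import Data.Bool using (Bool; true; false; if_then_else_; _∧_; not)
open import Data.Bool.Properties using (¬-not; not-¬; not-involutive) renaming (_≟_ to _≟ᵇ_)
open import Data.Integer using (+_)
open import Data.Product using (_×_; _,_; proj₁; proj₂)
open import Data.List using (List; []; _∷_; _++_; map; concatMap; allFin; length)
open import Data.List.Properties using (map-++; map-∘; map-cong; length-tabulate)
open import Data.List.Membership.Propositional using (_∈_)
open import Data.List.Membership.Propositional.Properties using (∈-allFin)
open import Data.List.Relation.Unary.Any using (here; there)
open import Function using (_∘_)
open import Relation.Nullary using (yes; no; contradiction)
open import Relation.Binary.PropositionalEquality using (_≡_; _≢_; refl; sym; trans; cong; module ≡-Reasoning)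

sum-map-concatMap : {A B : Set} (F : B → ℕ) (f : A → List B) (xs : List A) →
  sum (map F (concatMap f xs)) ≡ sum (map (λ a → sum (map F (f a))) xs)
sum-map-concatMap F f [] = refl
sum-map-concatMap F f (x ∷ xs) = begin
  sum (map F (f x ++ concatMap f xs))
    ≡⟨ cong sum (map-++ F (f x) (concatMap f xs)) ⟩
  sum (map F (f x) ++ map F (concatMap f xs))
    ≡⟨ sum-++ (map F (f x)) _ ⟩
  sum (map F (f x)) + sum (map F (concatMap f xs))
    ≡⟨ cong (_+_ (sum (map F (f x)))) (sum-map-concatMap F f xs) ⟩
  sum (map F (f x)) + sum (map (λ a → sum (map F (f a))) xs) ∎
  where open ≡-Reasoning

sum-map-mono : {A : Set} {f g : A → ℕ} (xs : List A) →
  (∀ a → f a ≤ g a) → sum (map f xs) ≤ sum (map g xs)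
sum-map-mono [] f≤g = z≤n
sum-map-mono (x ∷ xs) f≤g = +-mono-≤ (f≤g x) (sum-map-mono xs f≤g)

∈⇒≤sum-map : {A : Set} (f : A → ℕ) {x : A} {xs : List A} →
  x ∈ xs → f x ≤ sum (map f xs)
∈⇒≤sum-map f (here refl) = m≤m+n _ _
∈⇒≤sum-map f (there x∈xs) = ≤-trans (∈⇒≤sum-map f x∈xs) (m≤n+m _ _)

∑ : {q : ℕ} → (Fin q → ℕ) → ℕ
∑ {q} f = sum (map f (allFin q))

∑-mono : {q : ℕ} {f g : Fin q → ℕ} → (∀ a → f a ≤ g a) → ∑ f ≤ ∑ g
∑-mono {q} = sum-map-mono (allFin q)

≤-∑ : {q : ℕ} (f : Fin q → ℕ) (a : Fin q) → f a ≤ ∑ f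
≤-∑ f a = ∈⇒≤sum-map f (∈-allFin a)

sum-vertices : {q : ℕ} (F : Vertex q → ℕ) →
  sum (map F (vertices q)) ≡ ∑ λ a → ∑ λ b → ∑ λ c → F (a , b , c)
sum-vertices {q} F = begin
  sum (map F (vertices q))
    ≡⟨ sum-map-concatMap F plane (allFin q) ⟩
  ∑ (λ a → sum (map F (plane a)))
    ≡⟨ cong sum (map-cong (λ a → sum-map-concatMap F (line a) (allFin q)) (allFin q)) ⟩
  ∑ (λ a → ∑ λ b → sum (map F (line a b)))
    ≡⟨ cong sum (map-cong (λ a → cong sum (map-cong (λ b → cong sum (sym (map-∘ (allFin q)))) (allFin q))) (allFin q)) ⟩
  ∑ (λ a → ∑ λ b → ∑ λ c → F (a , b , c)) ∎
  where
  open ≡-Reasoning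
  line : Fin q → Fin q → List (Vertex q)
  line a b = map (λ c → (a , b , c)) (allFin q)
  plane : Fin q → List (Vertex q)
  plane a = concatMap (line a) (allFin q)

card-+-card-not : {q : ℕ} (X : Fin q → Bool) → card X + card (not ∘ X) ≡ q
card-+-card-not {q} X = trans (split (allFin q)) (length-tabulate (λ a → a))
  where
  split : (xs : List (Fin q)) →
    sum (map (λ a → if X a then 1 else 0) xs) + sum (map (λ a → if not (X a) then 1 else 0) xs) ≡ length xs
  split [] = refl
  split (x ∷ xs) with X x
  ... | true = cong suc (split xs)
  ... | false = trans (+-suc _ _) (cong suc (split xs))

coordinate : {q : ℕ} → Fin 3 → Vertex q → Fin q
coordinate Fin.zero (x₁ , x₂ , x₃) = x₁
coordinate (Fin.suc Fin.zero) (x₁ , x₂ , x₃) = x₂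
coordinate (Fin.suc (Fin.suc Fin.zero)) (x₁ , x₂ , x₃) = x₃

differ-refl : {q : ℕ} (a : Fin q) → differ a a ≡ 0
differ-refl a with a ≟ᶠ a
... | yes _ = refl
... | no a≢a = contradiction refl a≢a

differ-≢ : {q : ℕ} {a b : Fin q} → a ≢ b → differ a b ≡ 1
differ-≢ {a = a} {b} a≢b with a ≟ᶠ b
... | yes a≡b = contradiction a≡b a≢b
... | no _ = refl

adjacent-replace : {q : ℕ} (i : Fin 3) (x : Vertex q) {a : Fin q} →
  a ≢ coordinate i x → adjacent x (replace i x a) ≡ true
adjacent-replace Fin.zero (x₁ , x₂ , x₃) a≢x₁
  rewrite differ-≢ (a≢x₁ ∘ sym) | differ-refl x₂ | differ-refl x₃ = refl
adjacent-replace (Fin.suc Fin.zero) (x₁ , x₂ , x₃) a≢x₂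
  rewrite differ-refl x₁ | differ-≢ (a≢x₂ ∘ sym) | differ-refl x₃ = refl
adjacent-replace (Fin.suc (Fin.suc Fin.zero)) (x₁ , x₂ , x₃) a≢x₃
  rewrite differ-refl x₁ | differ-refl x₂ | differ-≢ (a≢x₃ ∘ sym) = refl

∑-line≤sum-vertices : {q : ℕ} (F : Vertex q → ℕ) (i : Fin 3) (x : Vertex q) →
  ∑ (F ∘ replace i x) ≤ sum (map F (vertices q))
∑-line≤sum-vertices F i x rewrite sum-vertices F = line≤ i x
  where
  line≤ : ∀ i x → ∑ (F ∘ replace i x) ≤ ∑ λ a → ∑ λ b → ∑ λ c → F (a , b , c)
  line≤ Fin.zero (x₁ , x₂ , x₃) =
    ∑-mono λ a → ≤-trans (≤-∑ (λ c → F (a , x₂ , c)) x₃) (≤-∑ (λ b → ∑ λ c → F (a , b , c)) x₂)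
  line≤ (Fin.suc Fin.zero) (x₁ , x₂ , x₃) =
    ≤-trans (∑-mono λ b → ≤-∑ (λ c → F (x₁ , b , c)) x₃) (≤-∑ (λ a → ∑ λ b → ∑ λ c → F (a , b , c)) x₁)
  line≤ (Fin.suc (Fin.suc Fin.zero)) (x₁ , x₂ , x₃) =
    ≤-trans (≤-∑ (λ b → ∑ λ c → F (x₁ , b , c)) x₂) (≤-∑ (λ a → ∑ λ b → ∑ λ c → F (a , b , c)) x₁)

card-≤-neighboursInside : {q : ℕ} (C : Code q) (x : Vertex q) (i : Fin 3) (P : Fin q → Bool) →
  (∀ a → P a ≡ true → a ≢ coordinate i x × C (replace i x a) ≡ true) →
  card P ≤ neighboursInside C x
card-≤-neighboursInside C x i P P⇒inC =
  ≤-trans (∑-mono counted) (∑-line≤sum-vertices (λ y → if adjacent x y ∧ C y then 1 else 0) i x)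
  where
  counted : ∀ a → (if P a then 1 else 0) ≤ (if adjacent x (replace i x a) ∧ C (replace i x a) then 1 else 0)
  counted a with P a in Pa
  ... | false = z≤n
  ... | true with P⇒inC a Pa
  ...   | a≢xᵢ , inC rewrite adjacent-replace i x a≢xᵢ | inC = ≤-refl

crossValue≡1 : {q : ℕ} (X Y : Fin q → Bool) {a b : Fin q} →
  crossValue X Y (a , b) ≡ + 1 → X a ≡ true × Y b ≡ false
crossValue≡1 X Y {a} {b} with X a | Y b
... | true | false = λ _ → refl , refl
... | true | true = λ ()
... | false | true = λ ()
... | false | false = λ ()

module _ {q : ℕ} (C : Code q) {u v : Fin q} (X Y : Fin q → Bool) {a b : Fin q} where

  cross⇒inLayerU : χ₃ C u v (a , b) ≡ crossValue X Y (a , b) →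
    X a ≡ true → Y b ≡ false → C (a , b , u) ≡ true
  cross⇒inLayerU with C (a , b , u) | C (a , b , v) | X a | Y b
  ... | true | _ | _ | _ = λ _ _ _ → refl
  ... | false | _ | false | _ = λ _ ()
  ... | false | _ | true | true = λ _ _ ()
  ... | false | false | true | false = λ ()
  ... | false | true | true | false = λ ()

  cross⇒inLayerV : χ₃ C u v (a , b) ≡ crossValue X Y (a , b) →
    X a ≡ false → Y b ≡ true → C (a , b , v) ≡ true
  cross⇒inLayerV with C (a , b , u) | C (a , b , v) | X a | Y b
  ... | _ | true | _ | _ = λ _ _ _ → refl
  ... | _ | false | true | _ = λ _ ()
  ... | _ | false | false | false = λ _ _ ()
  ... | false | false | false | true = λ ()
  ... | true | false | false | true = λ ()

  cross⇒layersAgree : χ₃ C u v (a , b) ≡ crossValue X Y (a , b) →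
    X a ≡ Y b → C (a , b , u) ≡ C (a , b , v)
  cross⇒layersAgree with C (a , b , u) | C (a , b , v) | X a | Y b
  ... | true | true | _ | _ = λ _ _ → refl
  ... | false | false | _ | _ = λ _ _ → refl
  ... | _ | _ | true | false = λ _ ()
  ... | _ | _ | false | true = λ _ ()
  ... | true | false | true | true = λ ()
  ... | true | false | false | false = λ ()
  ... | false | true | true | true = λ ()
  ... | false | true | false | false = λ ()

module CrossNeighbours {q : ℕ} {C : Code q} {γ : ℕ} (inside≡γ : ∀ x → C x ≡ false → neighboursInside C x ≡ γ)
         {u v : Fin q} {X Y : Fin q → Bool} (isCross : ∀ y → χ₃ C u v y ≡ crossValue X Y y) where

  open ≤-Reasoning

  card-not-X≤γ : ∀ x₁ b → X x₁ ≡ true → C (x₁ , b , u) ≡ false → card (not ∘ X) ≤ γ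
  card-not-X≤γ x₁ b Xx₁ ∉C = begin
    card (not ∘ X)                   ≤⟨ card-≤-neighboursInside C (x₁ , b , v) Fin.zero (not ∘ X) onLine ⟩
    neighboursInside C (x₁ , b , v)  ≡⟨ inside≡γ _ ∉Cᵥ ⟩
    γ                                ∎
    where
    Yb : Y b ≡ true
    Yb = ¬-not λ ¬Yb → not-¬ ∉C (cross⇒inLayerU C X Y (isCross _) Xx₁ ¬Yb)
    ∉Cᵥ : C (x₁ , b , v) ≡ false
    ∉Cᵥ = trans (sym (cross⇒layersAgree C X Y (isCross _) (trans Xx₁ (sym Yb)))) ∉C
    onLine : ∀ a → not (X a) ≡ true → a ≢ x₁ × C (a , b , v) ≡ true
    onLine a notXa = (λ { refl → not-¬ ¬Xa Xx₁ }) , cross⇒inLayerV C X Y (isCross _) ¬Xa Yb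
      where
      ¬Xa : X a ≡ false
      ¬Xa = trans (sym (not-involutive (X a))) (cong not notXa)

  card-Y≤γ : ∀ a x₂ → Y x₂ ≡ false → C (a , x₂ , u) ≡ false → card Y ≤ γ
  card-Y≤γ a x₂ ¬Yx₂ ∉C = begin
    card Y                           ≤⟨ card-≤-neighboursInside C (a , x₂ , v) (Fin.suc Fin.zero) Y onLine ⟩
    neighboursInside C (a , x₂ , v)  ≡⟨ inside≡γ _ ∉Cᵥ ⟩
    γ                                ∎
    where
    ¬Xa : X a ≡ false
    ¬Xa = ¬-not λ Xa → not-¬ ∉C (cross⇒inLayerU C X Y (isCross _) Xa ¬Yx₂)
    ∉Cᵥ : C (a , x₂ , v) ≡ false
    ∉Cᵥ = trans (sym (cross⇒layersAgree C X Y (isCross _) (trans ¬Xa (sym ¬Yx₂)))) ∉C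
    onLine : ∀ b → Y b ≡ true → b ≢ x₂ × C (a , b , v) ≡ true
    onLine b Yb = (λ { refl → not-¬ ¬Yx₂ Yb }) , cross⇒inLayerV C X Y (isCross _) ¬Xa Yb

lemma7 : (q : ℕ) → 2 ≤ q → (C : Code q) → (β γ : ℕ) →
    IsCRC1 C β γ → HasEigenvalueλ₂ q β γ → 2 * γ < q →
    (x₁ x₂ u v : Fin q) → C (x₁ , x₂ , u) ≡ true →
    IsCross (χ₃ C u v) → χ₃ C u v (x₁ , x₂) ≡ + 1 →
    InMaxCliqueInside C (x₁ , x₂ , u)
lemma7 q _ C β γ (_ , _ , _ , _ , _ , inside≡γ) _ 2γ<q x₁ x₂ u v _ (X , Y , _ , _ , |X|≡|Y| , isCross) χ₃≡1
  with all? (λ b → C (x₁ , b , u) ≟ᵇ true) | all? (λ a → C (a , x₂ , u) ≟ᵇ true)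
... | yes line₂⊆C | _ = Fin.suc Fin.zero , line₂⊆C
... | no _ | yes line₁⊆C = Fin.zero , line₁⊆C
... | no line₂⊈C | no line₁⊈C with ¬∀⟶∃¬ q _ (λ b → C (x₁ , b , u) ≟ᵇ true) line₂⊈C
                                  | ¬∀⟶∃¬ q _ (λ a → C (a , x₂ , u) ≟ᵇ true) line₁⊈C
...   | b , b∉C | a , a∉C = contradiction q≤2γ (<⇒≱ 2γ<q)
  where
  open ≤-Reasoning
  open CrossNeighbours inside≡γ {u} {v} {X} {Y} isCross
  Xx₁×¬Yx₂ : X x₁ ≡ true × Y x₂ ≡ false
  Xx₁×¬Yx₂ = crossValue≡1 X Y (trans (sym (isCross (x₁ , x₂))) χ₃≡1)
  q≤2γ : q ≤ 2 * γ
  q≤2γ = begin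
    q                           ≡⟨ card-+-card-not X ⟨
    card X + card (not ∘ X)     ≡⟨ cong (λ n → n + card (not ∘ X)) |X|≡|Y| ⟩
    card Y + card (not ∘ X)     ≤⟨ +-mono-≤ (card-Y≤γ a x₂ (proj₂ Xx₁×¬Yx₂) (¬-not a∉C))
                                            (card-not-X≤γ x₁ b (proj₁ Xx₁×¬Yx₂) (¬-not b∉C)) ⟩
    γ + γ                       ≡⟨ cong (_+_ γ) (+-identityʳ γ) ⟨
    2 * γ                       ∎
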